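{- Let $k,\ell$ be positive integers. (1) A graph $G$ has an edge-$\ell$-color-avoiding $k$-edge-connected coloring if and only if $G$ is $(k+\ell)$-edge-connected. (2) A digraph $D$ has an arc-$\ell$-color-avoiding strongly $k$-arc-connected coloring if and only if $D$ is strongly $(k+\ell)$-arc-connected. (3) A digraph $D$ with a given vertex $r\in V(D)$ has an arc-$\ell$-color-avoiding $r$-rooted $k$-arc-connected coloring if and only if $D$ is $r$-rooted $(k+\ell)$-arc-connected.
   Context: Graphs and digraphs may have loops and parallel edges/arcs. For $k\in\mathbb{Z}_+$: a graph is $k$-edge-connected if it has at least two vertices and there are at least $k$ pairwise edge-disjoint paths between any two vertices, or if it is a one-vertex graph with at least $k$ loops. A digraph is strongly $k$-arc-connected if it has at least two vertices and there are at least $k$ pairwise arc-disjoint dipaths from any vertex to any other vertex, or if it is a one-vertex digraph with at least $k$ loops. A digraph with a vertex $r$ is $r$-rooted $k$-arc-connected if it has at least two vertices and there are at least $k$ pairwise arc-disjoint dipaths from $r$ to every other vertex, or if it is a one-vertex digraph with at least $k$ loops. A coloring of the edges (arcs) is any function $f\colon E\to C$ to a finite color set $C$ (not necessarily proper). The edge-colored graph is edge-$\ell$-color-avoiding $k$-edge-connected if for every $C'\subseteq C$ with $|C'|\le\ell$, the graph obtained by deleting all edges whose color lies in $C'$ is $k$-edge-connected; such an $f$ is called an edge-$\ell$-color-avoiding $k$-edge-connected coloring. Arc-$\ell$-color-avoiding strongly $k$-arc-connected and arc-$\ell$-color-avoiding $r$-rooted $k$-arc-connected colorings of digraphs are defined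 analogously (after deleting the arcs of any at most $\ell$ colors, the digraph is strongly $k$-arc-connected, resp. $r$-rooted $k$-arc-connected). -}

module Defs where

open import Data.Nat using (ℕ; _≤_; _+_; suc)
open import Data.Fin using (Fin; _≟_)
open import Data.Fin.Subset using (Subset; _∈_; _∉_; ∣_∣; _∩_; ⊤; inside; outside)
open import Data.Fin.Subset.Properties using (_∈?_)
open import Data.Vec using (tabulate)
open import Data.List using (List; []; _∷_)
import Data.List.Membership.Propositional as LM
open import Data.List.Relation.Unary.Unique.Propositional using (Unique)
open import Data.Product using (Σ; _×_; _,_; proj₁; proj₂; ∃)
open import Data.Sum using (_⊎_)
open import Data.Bool using (if_then_else_)
open import Relation.Nullary using (¬_; does)
open import Relation.Binary.PropositionalEquality using (_≡_; _≢_)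

-- Undirected multigraph: each edge has an (unordered) pair of endpoints,
-- stored as a pair and read symmetrically.
record Graph : Set where
  field
    nV nE : ℕ
    ends  : Fin nE → Fin nV × Fin nV

record Digraph : Set where
  field
    nV nE : ℕ
    tail head : Fin nE → Fin nV

-- Generic walks / paths over an edge set S, w.r.t. a "step" relation
-- Step e u w : edge e may be traversed from u to w.

module Paths {n m : ℕ} (Step : Fin m → Fin n → Fin n → Set) (S : Subset m) where

  data Walk : Fin n → Fin n → Set where
    [] : ∀ {u} → Walk u u
    step : ∀ {u w v} (e : Fin m) → e ∈ S → Step e u w → Walk w v → Walk u v

  vertices : ∀ {u v} → Walk u v → List (Fin n)
  vertices {u} [] = u ∷ []
  vertices {u} (step e _ _ p) = u ∷ vertices p

  edges : ∀ {u v} → Walk u v → List (Fin m)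
  edges [] = []
  edges (step e _ _ p) = e ∷ edges p

  Path : Fin n → Fin n → Set
  Path u v = Σ (Walk u v) (λ p → Unique (vertices p))

  EdgeDisjoint : ∀ {u v u' v'} → Path u v → Path u' v' → Set
  EdgeDisjoint p q = ∀ e → e LM.∈ edges (proj₁ p) → e LM.∈ edges (proj₁ q) → Data.Empty.⊥
    where import Data.Empty

  KDisjointPaths : ℕ → Fin n → Fin n → Set
  KDisjointPaths k u v =
    Σ (Fin k → Path u v) λ P → ∀ i j → i ≢ j → EdgeDisjoint (P i) (P j)

loopSet : ∀ {n m} → (Fin m → Fin n × Fin n) → Subset m
loopSet en = tabulate λ e → if does (proj₁ (en e) ≟ proj₂ (en e)) then inside else outside

module _ (G : Graph) where
  open Graph G

  GStep : Fin nE → Fin nV → Fin nV → Set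
  GStep e u w = ends e ≡ (u , w) ⊎ ends e ≡ (w , u)

  EdgeConnIn : Subset nE → ℕ → Set
  EdgeConnIn S k =
    (2 ≤ nV × (∀ u v → u ≢ v → Paths.KDisjointPaths GStep S k u v))
    ⊎ (nV ≡ 1 × k ≤ ∣ S ∩ loopSet ends ∣)

  EdgeConnected : ℕ → Set
  EdgeConnected k = EdgeConnIn ⊤ k

module _ (D : Digraph) where
  open Digraph D

  DStep : Fin nE → Fin nV → Fin nV → Set
  DStep e u w = tail e ≡ u × head e ≡ w

  arcEnds : Fin nE → Fin nV × Fin nV
  arcEnds e = tail e , head e

  StronglyConnIn : Subset nE → ℕ → Set
  StronglyConnIn S k =
    (2 ≤ nV × (∀ u v → u ≢ v → Paths.KDisjointPaths DStep S k u v))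
    ⊎ (nV ≡ 1 × k ≤ ∣ S ∩ loopSet arcEnds ∣)

  StronglyConnected : ℕ → Set
  StronglyConnected k = StronglyConnIn ⊤ k

  RootedConnIn : Fin nV → Subset nE → ℕ → Set
  RootedConnIn r S k =
    (2 ≤ nV × (∀ v → r ≢ v → Paths.KDisjointPaths DStep S k r v))
    ⊎ (nV ≡ 1 × k ≤ ∣ S ∩ loopSet arcEnds ∣)

  RootedConnected : Fin nV → ℕ → Set
  RootedConnected r k = RootedConnIn r ⊤ k

surviving : ∀ {m c} → (Fin m → Fin c) → Subset c → Subset m
surviving f C' = tabulate λ e → if does (f e ∈? C') then outside else inside

module _ (G : Graph) where
  open Graph G
  EdgeColorAvoidingColoring : ∀ {c} → (Fin nE → Fin c) → ℕ → ℕ → Set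
  EdgeColorAvoidingColoring {c} f ℓ k =
    ∀ (C' : Subset c) → ∣ C' ∣ ≤ ℓ → EdgeConnIn G (surviving f C') k

  HasEdgeColorAvoidingColoring : ℕ → ℕ → Set
  HasEdgeColorAvoidingColoring ℓ k =
    Σ ℕ λ c → Σ (Fin nE → Fin c) λ f → EdgeColorAvoidingColoring f ℓ k

module _ (D : Digraph) where
  open Digraph D
  ArcColorAvoidingStrongColoring : ∀ {c} → (Fin nE → Fin c) → ℕ → ℕ → Set
  ArcColorAvoidingStrongColoring {c} f ℓ k =
    ∀ (C' : Subset c) → ∣ C' ∣ ≤ ℓ → StronglyConnIn D (surviving f C') k

  HasArcColorAvoidingStrongColoring : ℕ → ℕ → Set
  HasArcColorAvoidingStrongColoring ℓ k =
    Σ ℕ λ c → Σ (Fin nE → Fin c) λ f → ArcColorAvoidingStrongColoring f ℓ k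

  ArcColorAvoidingRootedColoring : Fin nV → ∀ {c} → (Fin nE → Fin c) → ℕ → ℕ → Set
  ArcColorAvoidingRootedColoring r {c} f ℓ k =
    ∀ (C' : Subset c) → ∣ C' ∣ ≤ ℓ → RootedConnIn D r (surviving f C') k

  HasArcColorAvoidingRootedColoring : Fin nV → ℕ → ℕ → Set
  HasArcColorAvoidingRootedColoring r ℓ k =
    Σ ℕ λ c → Σ (Fin nE → Fin c) λ f → ArcColorAvoidingRootedColoring r f ℓ k

-- One direction is direct: colour every edge differently; deleting ℓ colours then deletes at
-- most ℓ edges, each lying on at most one of k + ℓ edge-disjoint paths, so k paths survive.
-- Conversely, if there are no k + ℓ edge-disjoint u–v paths, Menger's theorem gives a set R with
-- u ∈ R, v ∉ R left by fewer than k + ℓ edges; deleting the colours of ℓ of these edges leaves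
-- fewer than k of them, but each of k edge-disjoint u–v paths must leave R along its own edge.
-- One-vertex (di)graphs are the same count applied to the loops.
--
-- Menger's theorem is proved with 0/1 flows. A flow of value J either has an augmenting path in
-- its residual graph, or the vertices reachable from u in it form a set left by exactly J arcs;
-- and a flow of value J decomposes into J arc-disjoint paths, peeled off one at a time. For a
-- graph, flows run in the digraph with both orientations of every edge, after cancelling the
-- flow on every pair of opposite arcs so that distinct flow arcs come from distinct edges.
module Submission where

open import Defs
open import Data.Nat as ℕ using (ℕ; zero; suc; _≤_; _<_; z≤n; s≤s)
import Data.Nat.Properties as ℕP
open import Data.Integer using (ℤ; +_)
import Data.Integer.Properties as ℤP
open import Data.Integer.Tactic.RingSolver using (solve-∀)
open import Algebra.Properties.Semiring.Sum ℤP.+-*-semiring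
  using (sum; sum-syntax; ∑-distrib-+; ∑-comm; *-distribˡ-sum; sum-cong-≗; sum-replicate-zero)
open import Algebra.Properties.CommutativeSemigroup ℕP.+-commutativeSemigroup
  using () renaming (interchange to +-interchange)
open import Data.Bool as Bool using (Bool; true; false; not; _∧_; _∨_; _xor_)
open import Data.Bool.Properties using (∨-zeroʳ; ∧-zeroʳ)
open import Data.Fin as Fin using (Fin; zero; suc; _↑ˡ_; _↑ʳ_; splitAt; punchIn; inject≤)
open import Data.Fin.Properties
  using (_≟_; suc-injective; any?; injective⇒≤; punchIn-injective; punchInᵢ≢i; inject≤-injective;
         splitAt-↑ˡ; splitAt-↑ʳ; splitAt⁻¹-↑ˡ; splitAt⁻¹-↑ʳ)
open import Data.Fin.Subset using (Subset; ∣_∣; _∩_; ⊤; ⊥; inside; outside) renaming (_∈_ to _∈ₛ_)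
open import Data.Fin.Subset.Properties using (∈⊤; ∩-identityˡ; ∣⊥∣≡0) renaming (_∈?_ to _∈ₛ?_)
open import Data.Vec as Vec using (lookup; tabulate)
import Data.Vec.Properties as VecP
open import Data.List using (List; []; _∷_; length; map; allFin; take; drop)
open import Data.List.Properties using (length-map; map-id; length-drop; length-take; take++drop≡id)
open import Data.List.Membership.Propositional using (_∈_)
open import Data.List.Membership.Propositional.Properties using (∈-map⁺; ∈-map⁻; ∈-allFin; ∈-++⁻)
open import Data.List.Relation.Unary.Any as Any using (here; there)
open import Data.List.Relation.Unary.Any.Properties using (lookup-index)
open import Data.List.Relation.Unary.All as All using ([]; _∷_)
open import Data.List.Relation.Unary.AllPairs using ([]; _∷_)
open import Data.List.Relation.Unary.Unique.Propositional using (Unique)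
open import Data.Product using (Σ; _×_; _,_; proj₁; proj₂; ∃; swap)
open import Data.Sum using (_⊎_; inj₁; inj₂; map₁; [_,_]′)
open import Data.Empty using (⊥-elim)
open import Function using (_∘_; id)
open import Relation.Binary.PropositionalEquality
open import Relation.Nullary using (¬_; Dec; yes; no; does)
open import Function.Bundles using (_⇔_; mk⇔)
open import Relation.Nullary.Decidable using (dec-true; dec-false; _×-dec_)

infix 4 _≡ᵇ_
_≡ᵇ_ : ∀ {n} → Fin n → Fin n → Bool
x ≡ᵇ y = does (x ≟ y)

≡ᵇ-refl : ∀ {n} (x : Fin n) → (x ≡ᵇ x) ≡ true
≡ᵇ-refl x = dec-true (x ≟ x) refl

≢⇒≡ᵇ-false : ∀ {n} {x y : Fin n} → x ≢ y → (x ≡ᵇ y) ≡ false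
≢⇒≡ᵇ-false {x = x} {y} = dec-false (x ≟ y)

≡ᵇ-true⇒≡ : ∀ {n} {x y : Fin n} → (x ≡ᵇ y) ≡ true → x ≡ y
≡ᵇ-true⇒≡ {x = x} {y} eq with x ≟ y
... | yes x≡y = x≡y
≡ᵇ-true⇒≡ () | no _

infix 4 _⊆ᵇ_
_⊆ᵇ_ : ∀ {m} → (Fin m → Bool) → (Fin m → Bool) → Set
X ⊆ᵇ Y = ∀ a → X a ≡ true → Y a ≡ true

fromBool : Bool → ℕ
fromBool true = 1
fromBool false = 0

count : ∀ {m} → (Fin m → Bool) → ℕ
count {zero} b = 0
count {suc m} b = fromBool (b zero) ℕ.+ count (b ∘ suc)

count-cong : ∀ {m} {b b′ : Fin m → Bool} → (∀ x → b x ≡ b′ x) → count b ≡ count b′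
count-cong {zero} eq = refl
count-cong {suc m} eq = cong₂ ℕ._+_ (cong fromBool (eq zero)) (count-cong (eq ∘ suc))

count-false : ∀ {m} {b : Fin m → Bool} → (∀ x → b x ≡ false) → count b ≡ 0
count-false {zero} eq = refl
count-false {suc m} {b} eq rewrite eq zero = count-false (eq ∘ suc)

count≤n : ∀ {m} (b : Fin m → Bool) → count b ≤ m
count≤n {zero} b = z≤n
count≤n {suc m} b with b zero
... | true = s≤s (count≤n (b ∘ suc))
... | false = ℕP.m≤n⇒m≤1+n (count≤n (b ∘ suc))

count-≤-+ : ∀ {m} {b b₁ b₂ : Fin m → Bool} →
  (∀ x → fromBool (b x) ≤ fromBool (b₁ x) ℕ.+ fromBool (b₂ x)) → count b ≤ count b₁ ℕ.+ count b₂
count-≤-+ {zero} le = z≤n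
count-≤-+ {suc m} {b} {b₁} {b₂} le = begin
  fromBool (b zero) ℕ.+ count (b ∘ suc)
    ≤⟨ ℕP.+-mono-≤ (le zero) (count-≤-+ (le ∘ suc)) ⟩
  (fromBool (b₁ zero) ℕ.+ fromBool (b₂ zero)) ℕ.+ (count (b₁ ∘ suc) ℕ.+ count (b₂ ∘ suc))
    ≡⟨ +-interchange (fromBool (b₁ zero)) _ _ _ ⟩
  count b₁ ℕ.+ count b₂ ∎
  where open ℕP.≤-Reasoning

count-insert : ∀ {m} (b : Fin m → Bool) (w : Fin m) → b w ≡ false →
  count (λ v → (v ≡ᵇ w) ∨ b v) ≡ suc (count b)
count-insert {suc m} b zero bw rewrite bw = refl
count-insert {suc m} b (suc w) bw =
  trans (cong (fromBool (b zero) ℕ.+_) (count-insert (b ∘ suc) w bw)) (ℕP.+-suc (fromBool (b zero)) _)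

count-singleton : ∀ {m} (d : Fin m) → count (_≡ᵇ d) ≡ 1
count-singleton {suc m} zero = cong suc (count-false {m} (λ _ → refl))
count-singleton {suc m} (suc d) = count-singleton d

count≤length : ∀ {m} {b : Fin m → Bool} (D : List (Fin m)) → (∀ x → b x ≡ true → x ∈ D) →
  count b ≤ length D
count≤length {b = b} [] covers = ℕP.≤-reflexive (count-false λ x → notCovered x (b x) refl)
  where
  notCovered : ∀ x c → b x ≡ c → b x ≡ false
  notCovered x false bx = bx
  notCovered x true bx with () ← covers x bx
count≤length {m} {b} (d ∷ D) covers = begin
  count b                     ≤⟨ count-≤-+ {b = b} {b₁ = _≡ᵇ d} {b₂ = b′} split ⟩
  count (_≡ᵇ d) ℕ.+ count b′  ≡⟨ cong (ℕ._+ count b′) (count-singleton d) ⟩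
  suc (count b′)              ≤⟨ s≤s (count≤length D covers′) ⟩
  suc (length D)              ∎
  where
  open ℕP.≤-Reasoning
  b′ : Fin m → Bool
  b′ x = b x ∧ not (x ≡ᵇ d)
  split : ∀ x → fromBool (b x) ≤ fromBool (x ≡ᵇ d) ℕ.+ fromBool (b′ x)
  split x with b x | x ≡ᵇ d
  ... | true | true = s≤s z≤n
  ... | true | false = s≤s z≤n
  ... | false | _ = z≤n
  covers′ : ∀ x → b′ x ≡ true → x ∈ D
  covers′ x b′x with b x in bx | x ≟ d
  covers′ x b′x | true | no x≢d with covers x bx
  ... | here x≡d = ⊥-elim (x≢d x≡d)
  ... | there x∈D = x∈D
  covers′ x () | true | yes _
  covers′ x () | false | _

∣p∣≡count : ∀ {m} (p : Subset m) → ∣ p ∣ ≡ count (lookup p)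
∣p∣≡count Vec.[] = refl
∣p∣≡count (true Vec.∷ p) = cong suc (∣p∣≡count p)
∣p∣≡count (false Vec.∷ p) = ∣p∣≡count p

∣p∩q∣≡count : ∀ {m} (p q : Subset m) → ∣ p ∩ q ∣ ≡ count (λ e → lookup p e ∧ lookup q e)
∣p∩q∣≡count p q = trans (∣p∣≡count (p ∩ q)) (count-cong λ e → VecP.lookup-zipWith _∧_ e p q)

elements : ∀ {m} → (Fin m → Bool) → List (Fin m)
elements {zero} b = []
elements {suc m} b with b zero
... | true = zero ∷ map suc (elements (b ∘ suc))
... | false = map suc (elements (b ∘ suc))

length-elements : ∀ {m} (b : Fin m → Bool) → length (elements b) ≡ count b
length-elements {zero} b = refl
length-elements {suc m} b with b zero
... | true = cong suc (trans (length-map Fin.suc (elements (b ∘ suc))) (length-elements (b ∘ suc)))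
... | false = trans (length-map Fin.suc (elements (b ∘ suc))) (length-elements (b ∘ suc))

∈-elements : ∀ {m} (b : Fin m → Bool) x → b x ≡ true → x ∈ elements b
∈-elements {suc m} b zero bx rewrite bx = here refl
∈-elements {suc m} b (suc x) bx with b zero
... | true = there (∈-map⁺ suc (∈-elements (b ∘ suc) x bx))
... | false = ∈-map⁺ suc (∈-elements (b ∘ suc) x bx)

module _ {n m m′ : ℕ} {Step : Fin m → Fin n → Fin n → Set} {S : Subset m}
         {Step′ : Fin m′ → Fin n → Fin n → Set} {S′ : Subset m′} (g : Fin m → Fin m′) where
  private
    module A = Paths Step S
    module B = Paths Step′ S′

  StepsMapTo : ∀ {u v} → A.Walk u v → Set
  StepsMapTo p = ∀ {e x y} → e ∈ A.edges p → Step e x y → Step′ (g e) x y × g e ∈ₛ S′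

  mapWalk : ∀ {u v} (p : A.Walk u v) → StepsMapTo p → B.Walk u v
  mapWalk A.[] h = B.[]
  mapWalk (A.step e _ st p) h =
    B.step (g e) (proj₂ (h (here refl) st)) (proj₁ (h (here refl) st)) (mapWalk p (λ e∈ → h (there e∈)))

  vertices-mapWalk : ∀ {u v} (p : A.Walk u v) (h : StepsMapTo p) → B.vertices (mapWalk p h) ≡ A.vertices p
  vertices-mapWalk A.[] h = refl
  vertices-mapWalk {u} (A.step e _ st p) h = cong (u ∷_) (vertices-mapWalk p (λ e∈ → h (there e∈)))

  edges-mapWalk : ∀ {u v} (p : A.Walk u v) (h : StepsMapTo p) → B.edges (mapWalk p h) ≡ map g (A.edges p)
  edges-mapWalk A.[] h = refl
  edges-mapWalk (A.step e _ st p) h = cong (g e ∷_) (edges-mapWalk p (λ e∈ → h (there e∈)))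

  mapPath : ∀ {u v} (p : A.Path u v) → StepsMapTo (proj₁ p) → B.Path u v
  mapPath (p , distinct) h = mapWalk p h , subst Unique (sym (vertices-mapWalk p h)) distinct

module _ {n m m′ : ℕ} {Step : Fin m → Fin n → Fin n → Set} {Step′ : Fin m′ → Fin n → Fin n → Set}
         (g : Fin m → Fin m′) (g-step : ∀ {e x y} → Step e x y → Step′ (g e) x y)
         (g-injective : ∀ {a b x y x′ y′} → Step a x y → Step b x′ y′ → g a ≡ g b → a ≡ b) where
  private
    module A = Paths Step ⊤
    module B = Paths Step′ ⊤

    stepOf : ∀ {u v} (p : A.Walk u v) {e} → e ∈ A.edges p → ∃ λ x → ∃ λ y → Step e x y
    stepOf (A.step e _ st p) (here refl) = _ , _ , st
    stepOf (A.step e _ st p) (there e∈p) = stepOf p e∈p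

  mapDisjointPaths : ∀ {J u v} → A.KDisjointPaths J u v → B.KDisjointPaths J u v
  mapDisjointPaths (P , disjoint) = P′ , disjoint′
    where
    P′ : ∀ i → B.Path _ _
    P′ i = mapPath g (P i) (λ _ st → g-step st , ∈⊤)
    preimage : ∀ i {e} → e ∈ B.edges (proj₁ (P′ i)) → ∃ λ a → a ∈ A.edges (proj₁ (P i)) × e ≡ g a
    preimage i {e} e∈ = ∈-map⁻ g (subst (e ∈_) (edges-mapWalk g (proj₁ (P i)) _) e∈)
    disjoint′ : ∀ i j → i ≢ j → B.EdgeDisjoint (P′ i) (P′ j)
    disjoint′ i j i≢j e e∈i e∈j
      with a , a∈i , refl ← preimage i e∈i | b , b∈j , ga≡gb ← preimage j e∈j
      with _ , _ , sta ← stepOf (proj₁ (P i)) a∈i | _ , _ , stb ← stepOf (proj₁ (P j)) b∈j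
      with refl ← g-injective sta stb ga≡gb = disjoint i j i≢j a a∈i b∈j

Closed : ∀ {n m} → (Fin m → Fin n → Fin n → Set) → Subset m → (Fin n → Bool) → Set
Closed Step S R = ∀ e u w → R u ≡ true → e ∈ₛ S → Step e u w → R w ≡ true

module _ {n m : ℕ} {Step : Fin m → Fin n → Fin n → Set} {S : Subset m} where
  open Paths Step S
  open import Data.List.Membership.DecPropositional (_≟_ {n}) using () renaming (_∈?_ to _∈?ᵥ_)

  suffix : ∀ {u w v} (q : Walk w v) → Unique (vertices q) → u ∈ vertices q → Path u v
  suffix [] distinct (here refl) = [] , distinct
  suffix (step e e∈S st q) distinct (here refl) = step e e∈S st q , distinct
  suffix (step e e∈S st q) (_ ∷ distinct) (there u∈q) = suffix q distinct u∈q

  toPath : ∀ {u v} → Walk u v → Path u v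
  toPath [] = [] , ([] ∷ [])
  toPath {u} (step e e∈S st p) with toPath p
  ... | q , distinct with u ∈?ᵥ vertices q
  ... | yes u∈q = suffix q distinct u∈q
  ... | no u∉q = step e e∈S st q , (All.tabulate (λ { x∈q refl → u∉q x∈q }) ∷ distinct)

  _∷ʳ⟨_,_,_⟩ : ∀ {u w v} → Walk u w → (e : Fin m) → e ∈ₛ S → Step e w v → Walk u v
  [] ∷ʳ⟨ e , e∈S , st ⟩ = step e e∈S st []
  step e′ e′∈S st′ p ∷ʳ⟨ e , e∈S , st ⟩ = step e′ e′∈S st′ (p ∷ʳ⟨ e , e∈S , st ⟩)

  leavingEdge : (R : Fin n → Bool) → ∀ {u v} (p : Walk u v) → R u ≡ true → R v ≡ false →
    Σ (Fin m) λ e → Σ (Fin n) λ x → Σ (Fin n) λ y →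
      e ∈ edges p × e ∈ₛ S × Step e x y × R x ≡ true × R y ≡ false
  leavingEdge R [] Ru Rv with () ← trans (sym Ru) Rv
  leavingEdge R {u} (step {w = w} e e∈S st p) Ru Rv with R w in Rw
  ... | false = e , u , w , here refl , e∈S , st , Ru , Rw
  ... | true with leavingEdge R p Rw Rv
  ... | e′ , x , y , e′∈p , rest = e′ , x , y , there e′∈p , rest

  module _ (step? : ∀ e u w → Dec (Step e u w)) (s : Fin n) where
    private
      Escape : (Fin n → Bool) → Set
      Escape R = ∃ λ e → ∃ λ u → ∃ λ w → (R u ≡ true × R w ≡ false) × (e ∈ₛ S × Step e u w)

      escape? : ∀ R → Dec (Escape R)
      escape? R = any? λ e → any? λ u → any? λ w →
        ((R u Bool.≟ true) ×-dec (R w Bool.≟ false)) ×-dec ((e ∈ₛ? S) ×-dec step? e u w)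

      Reached : (Fin n → Bool) → Set
      Reached R = R s ≡ true × (∀ v → R v ≡ true → Walk s v)

      -- Every step inserts a new vertex into R, so n units of fuel suffice.
      grow : (fuel : ℕ) (R : Fin n → Bool) → n ≤ count R ℕ.+ fuel → Reached R →
        Σ (Fin n → Bool) λ R′ → Reached R′ × Closed Step S R′
      grow fuel R bound reached with escape? R
      ... | no stuck = R , reached , closed
        where
        closed : Closed Step S R
        closed e u w Ru e∈S st with R w in Rw
        ... | true = refl
        ... | false = ⊥-elim (stuck (e , u , w , (Ru , Rw) , (e∈S , st)))
      grow zero R bound reached | yes (_ , _ , w , (_ , Rw) , _) =
        ⊥-elim (ℕP.<-irrefl refl (begin-strict
          count R                            <⟨ ℕP.n<1+n (count R) ⟩
          suc (count R)                      ≡⟨ count-insert R w Rw ⟨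
          count (λ v → (v ≡ᵇ w) ∨ R v)       ≤⟨ count≤n _ ⟩
          n                                  ≤⟨ bound ⟩
          count R ℕ.+ 0                      ≡⟨ ℕP.+-identityʳ (count R) ⟩
          count R                            ∎))
        where open ℕP.≤-Reasoning
      grow (suc fuel) R bound (Rs , walkTo) | yes (e , u , w , (Ru , Rw) , (e∈S , st)) =
        grow fuel (λ v → (v ≡ᵇ w) ∨ R v) bound′ (trans (cong ((s ≡ᵇ w) ∨_) Rs) (∨-zeroʳ _) , walkTo′)
        where
        bound′ : n ≤ count (λ v → (v ≡ᵇ w) ∨ R v) ℕ.+ fuel
        bound′ rewrite count-insert R w Rw = ℕP.≤-trans bound (ℕP.≤-reflexive (ℕP.+-suc (count R) fuel))
        walkTo′ : ∀ v → (v ≡ᵇ w) ∨ R v ≡ true → Walk s v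
        walkTo′ v inR′ with v ≟ w
        ... | yes refl = walkTo u Ru ∷ʳ⟨ e , e∈S , st ⟩
        ... | no _ = walkTo v inR′

    walkOrClosedCut : (t : Fin n) →
      Walk s t ⊎ Σ (Fin n → Bool) λ R → R s ≡ true × R t ≡ false × Closed Step S R
    walkOrClosedCut t
      with grow n (_≡ᵇ s) (ℕP.m≤n+m n _) (≡ᵇ-refl s , λ v v≡s → subst (Walk s) (sym (≡ᵇ-true⇒≡ v≡s)) [])
    ... | R , (Rs , walkTo) , closed with R t in Rt
    ... | true = inj₁ (walkTo t Rt)
    ... | false = inj₂ (R , Rs , Rt , closed)

module _ {n m : ℕ} (tl hd : Fin m → Fin n) {Step : Fin m → Fin n → Fin n → Set} {S : Subset m}
         (along : ∀ {e x y} → Step e x y → (tl e ≡ x × hd e ≡ y) ⊎ (tl e ≡ y × hd e ≡ x)) where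
  open Paths Step S

  start∈vertices : ∀ {u v} (p : Walk u v) → u ∈ vertices p
  start∈vertices [] = here refl
  start∈vertices (step e e∈S st p) = here refl

  endpoints∈vertices : ∀ {u v} (p : Walk u v) {e} → e ∈ edges p → tl e ∈ vertices p × hd e ∈ vertices p
  endpoints∈vertices (step e e∈S st p) (here refl) with along st
  ... | inj₁ (refl , refl) = here refl , there (start∈vertices p)
  ... | inj₂ (refl , refl) = there (start∈vertices p) , here refl
  endpoints∈vertices (step e e∈S st p) (there e∈p) with endpoints∈vertices p e∈p
  ... | tl∈p , hd∈p = there tl∈p , there hd∈p

  distinctVertices⇒distinctEdges : ∀ {u v} (p : Walk u v) → Unique (vertices p) → Unique (edges p)
  distinctVertices⇒distinctEdges [] _ = []
  distinctVertices⇒distinctEdges {u} (step e e∈S st p) (u∉p ∷ distinct) =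
    All.tabulate notOnTail ∷ distinctVertices⇒distinctEdges p distinct
    where
    notOnTail : ∀ {e′} → e′ ∈ edges p → e ≢ e′
    notOnTail e∈p refl with endpoints∈vertices p e∈p | along st
    ... | tl∈p , _ | inj₁ (refl , _) = All.lookup u∉p tl∈p refl
    ... | _ , hd∈p | inj₂ (_ , refl) = All.lookup u∉p hd∈p refl

SmallCut : ∀ {n m} (Step : Fin m → Fin n → Fin n → Set) → ℕ → Fin n → Fin n → Set
SmallCut {n} {m} Step J u v = Σ (Fin n → Bool) λ R → Σ (List (Fin m)) λ F →
  R u ≡ true × R v ≡ false × length F < J × (∀ e x y → Step e x y → R x ≡ true → R y ≡ false → e ∈ F)

Menger : ∀ {n m} → (Fin m → Fin n → Fin n → Set) → Set
Menger {n} Step = ∀ (u v : Fin n) J → Paths.KDisjointPaths Step ⊤ J u v ⊎ SmallCut Step J u v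

module _ {n m : ℕ} {Step : Fin m → Fin n → Fin n → Set} {S : Subset m} where
  open Paths Step S
  open import Data.List.Membership.DecPropositional (_≟_ {m}) using () renaming (_∈?_ to _∈?ₑ_)

  disjointPaths≤crossing : ∀ {k u v} (R : Fin n → Bool) (D : List (Fin m)) → KDisjointPaths k u v →
    R u ≡ true → R v ≡ false → (∀ e x y → e ∈ₛ S → Step e x y → R x ≡ true → R y ≡ false → e ∈ D) →
    k ≤ length D
  disjointPaths≤crossing {k} R D (P , disjoint) Ru Rv inD = injective⇒≤ index-injective
    where
    crossing : ∀ i → Σ (Fin (length D)) λ d → Data.List.lookup D d ∈ edges (proj₁ (P i))
    crossing i with e , x , y , e∈p , e∈S , st , Rx , Ry ← leavingEdge R (proj₁ (P i)) Ru Rv =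
      Any.index e∈D , subst (_∈ edges (proj₁ (P i))) (lookup-index e∈D) e∈p
      where
      e∈D : e ∈ D
      e∈D = inD e x y e∈S st Rx Ry
    index-injective : ∀ {i j} → proj₁ (crossing i) ≡ proj₁ (crossing j) → i ≡ j
    index-injective {i} {j} eq with i ≟ j
    ... | yes i≡j = i≡j
    ... | no i≢j = ⊥-elim (disjoint i j i≢j _ (proj₂ (crossing i))
                     (subst (λ d → Data.List.lookup D d ∈ edges (proj₁ (P j))) (sym eq) (proj₂ (crossing j))))

  selectAvoiding : ∀ {u v} (Ls : List (Fin m)) N (P : Fin (length Ls ℕ.+ N) → Path u v) →
    (∀ i j → i ≢ j → EdgeDisjoint (P i) (P j)) →
    Σ (Fin N → Fin (length Ls ℕ.+ N)) λ g → (∀ i j → g i ≡ g j → i ≡ j) ×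
      (∀ i e → e ∈ edges (proj₁ (P (g i))) → ¬ e ∈ Ls)
  selectAvoiding [] N P disjoint = id , (λ _ _ → id) , λ _ _ _ ()
  selectAvoiding (d ∷ Ls) N P disjoint with any? (λ i → d ∈?ₑ edges (proj₁ (P i)))
  ... | yes (i , d∈Pi)
    with g , g-injective , avoid ← selectAvoiding Ls N (P ∘ punchIn i)
                                     (λ a b a≢b → disjoint _ _ (a≢b ∘ punchIn-injective i a b)) =
    punchIn i ∘ g , (λ a b → g-injective a b ∘ punchIn-injective i _ _) , avoid′
    where
    avoid′ : ∀ a e → e ∈ edges (proj₁ (P (punchIn i (g a)))) → ¬ e ∈ d ∷ Ls
    avoid′ a e e∈ (here refl) = disjoint (punchIn i (g a)) i (punchInᵢ≢i i (g a)) e e∈ d∈Pi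
    avoid′ a e e∈ (there e∈Ls) = avoid a e e∈ e∈Ls
  ... | no d∉P
    with g , g-injective , avoid ← selectAvoiding Ls N (P ∘ suc)
                                     (λ a b a≢b → disjoint _ _ (a≢b ∘ suc-injective)) =
    suc ∘ g , (λ a b → g-injective a b ∘ suc-injective) , avoid′
    where
    avoid′ : ∀ a e → e ∈ edges (proj₁ (P (suc (g a)))) → ¬ e ∈ d ∷ Ls
    avoid′ a e e∈ (here refl) = d∉P (suc (g a) , e∈)
    avoid′ a e e∈ (there e∈Ls) = avoid a e e∈ e∈Ls

  fewerPaths : ∀ {J K u v} → J ≤ K → KDisjointPaths K u v → KDisjointPaths J u v
  fewerPaths J≤K (P , disjoint) =
    (λ i → P (inject≤ i J≤K)) , λ i j i≢j → disjoint _ _ (i≢j ∘ inject≤-injective _ _ i j)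

  disjointPathsAvoiding : ∀ {u v} (Ls : List (Fin m)) N → KDisjointPaths (length Ls ℕ.+ N) u v →
    Σ (KDisjointPaths N u v) λ Q → ∀ i e → e ∈ edges (proj₁ (proj₁ Q i)) → ¬ e ∈ Ls
  disjointPathsAvoiding Ls N (P , disjoint) with g , g-injective , avoid ← selectAvoiding Ls N P disjoint =
    (P ∘ g , λ i j i≢j → disjoint _ _ (i≢j ∘ g-injective i j)) , avoid

module IntegerSums where
  open import Data.Integer using (_+_; _-_; -_; _*_)

  ⟦_⟧ : Bool → ℤ
  ⟦ b ⟧ = + fromBool b

  δ : ∀ {n} → Fin n → Fin n → ℤ
  δ a v = ⟦ a ≡ᵇ v ⟧

  ∑-zero : ∀ {m} {f : Fin m → ℤ} → (∀ i → f i ≡ + 0) → sum f ≡ + 0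
  ∑-zero {m} eq = trans (sum-cong-≗ eq) (sum-replicate-zero m)

  ∑-neg : ∀ {m} (f : Fin m → ℤ) → ∑[ i < m ] (- f i) ≡ - sum f
  ∑-neg {zero} f = refl
  ∑-neg {suc m} f = trans (cong (λ x → - f zero + x) (∑-neg (f ∘ suc))) (sym (ℤP.neg-distrib-+ (f zero) _))

  ∑-⟦⟧ : ∀ {m} (b : Fin m → Bool) → ∑[ i < m ] ⟦ b i ⟧ ≡ + count b
  ∑-⟦⟧ {zero} b = refl
  ∑-⟦⟧ {suc m} b =
    trans (cong (λ x → ⟦ b zero ⟧ + x) (∑-⟦⟧ (b ∘ suc))) (sym (ℤP.pos-+ (fromBool (b zero)) _))

  ∑-δ : ∀ {n} (g : Fin n → ℤ) (a : Fin n) → ∑[ v < n ] (g v * δ a v) ≡ g a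
  ∑-δ {suc n} g zero = begin
    g zero * + 1 + ∑[ v < n ] (g (suc v) * + 0)
      ≡⟨ cong₂ _+_ (ℤP.*-identityʳ (g zero)) (∑-zero λ v → ℤP.*-zeroʳ (g (suc v))) ⟩
    g zero + + 0
      ≡⟨ ℤP.+-identityʳ (g zero) ⟩
    g zero ∎
    where open ≡-Reasoning
  ∑-δ {suc n} g (suc a) = begin
    g zero * + 0 + ∑[ v < n ] (g (suc v) * δ a v)
      ≡⟨ cong (λ x → x + ∑[ v < n ] (g (suc v) * δ a v)) (ℤP.*-zeroʳ (g zero)) ⟩
    + 0 + ∑[ v < n ] (g (suc v) * δ a v)
      ≡⟨ ℤP.+-identityˡ _ ⟩
    ∑[ v < n ] (g (suc v) * δ a v)
      ≡⟨ ∑-δ (g ∘ suc) a ⟩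
    g (suc a) ∎
    where open ≡-Reasoning

  ∑-update : ∀ {m} (f f′ : Fin m → ℤ) (e : Fin m) → (∀ i → i ≢ e → f′ i ≡ f i) →
    sum f′ ≡ sum f + (f′ e - f e)
  ∑-update {suc m} f f′ zero same
    rewrite sum-cong-≗ {x = f′ ∘ suc} {y = f ∘ suc} (λ i → same (suc i) λ ()) =
    shuffle (f′ zero) (f zero) (sum (f ∘ suc))
    where
    shuffle : ∀ a b c → a + c ≡ b + c + (a - b)
    shuffle = solve-∀
  ∑-update {suc m} f f′ (suc e) same
    rewrite same zero (λ ())
          | ∑-update (f ∘ suc) (f′ ∘ suc) e (λ i i≢e → same (suc i) (i≢e ∘ suc-injective)) =
    sym (ℤP.+-assoc (f zero) (sum (f ∘ suc)) _)

  ∑-δ-difference : ∀ {n} (g : Fin n → ℤ) (a b : Fin n) → ∑[ v < n ] (g v * (δ a v - δ b v)) ≡ g a - g b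
  ∑-δ-difference {n} g a b = begin
    ∑[ v < n ] (g v * (δ a v - δ b v))
      ≡⟨ sum-cong-≗ (λ v → ℤP.*-distribˡ-+ (g v) (δ a v) (- δ b v)) ⟩
    ∑[ v < n ] (g v * δ a v + g v * - δ b v)
      ≡⟨ ∑-distrib-+ (λ v → g v * δ a v) (λ v → g v * - δ b v) ⟩
    ∑[ v < n ] (g v * δ a v) + ∑[ v < n ] (g v * - δ b v)
      ≡⟨ cong (λ x → ∑[ v < n ] (g v * δ a v) + x)
              (trans (sum-cong-≗ (λ v → sym (ℤP.neg-distribʳ-* (g v) (δ b v)))) (∑-neg (λ v → g v * δ b v))) ⟩
    ∑[ v < n ] (g v * δ a v) - ∑[ v < n ] (g v * δ b v)
      ≡⟨ cong₂ _-_ (∑-δ g a) (∑-δ g b) ⟩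
    g a - g b ∎
    where open ≡-Reasoning


module Flow {n m : ℕ} (tl hd : Fin m → Fin n) where
  open IntegerSums
  open import Data.Integer using (_+_; _-_; -_; _*_; 1ℤ; -1ℤ)

  Arc : Fin m → Fin n → Fin n → Set
  Arc e u w = tl e ≡ u × hd e ≡ w

  incidence : Fin m → Fin n → ℤ
  incidence e v = δ (tl e) v - δ (hd e) v

  -- A 0/1 flow is the set X of arcs carrying one unit; net X v is its outflow minus its inflow at v.
  net : (Fin m → Bool) → Fin n → ℤ
  net X v = ∑[ e < m ] (⟦ X e ⟧ * incidence e v)

  net-∅ : ∀ v → net (λ _ → false) v ≡ + 0
  net-∅ v = ∑-zero {f = λ e → ⟦ false ⟧ * incidence e v} λ _ → refl

  toggle : (Fin m → Bool) → Fin m → Fin m → Bool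
  toggle X e e′ = (e′ ≡ᵇ e) xor X e′

  toggle-same : ∀ X e → toggle X e e ≡ not (X e)
  toggle-same X e rewrite ≡ᵇ-refl e = refl

  toggle-other : ∀ X {e e′} → e′ ≢ e → toggle X e e′ ≡ X e′
  toggle-other X e′≢e rewrite ≢⇒≡ᵇ-false e′≢e = refl

  net-toggle : ∀ X e v → net (toggle X e) v ≡ net X v + (⟦ not (X e) ⟧ - ⟦ X e ⟧) * incidence e v
  net-toggle X e v = begin
    net (toggle X e) v
      ≡⟨ ∑-update (λ e′ → ⟦ X e′ ⟧ * incidence e′ v) (λ e′ → ⟦ toggle X e e′ ⟧ * incidence e′ v) e
                  (λ e′ e′≢e → cong (λ b → ⟦ b ⟧ * incidence e′ v) (toggle-other X e′≢e)) ⟩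
    net X v + (⟦ toggle X e e ⟧ * incidence e v - ⟦ X e ⟧ * incidence e v)
      ≡⟨ cong (λ b → net X v + (⟦ b ⟧ * incidence e v - ⟦ X e ⟧ * incidence e v)) (toggle-same X e) ⟩
    net X v + (⟦ not (X e) ⟧ * incidence e v - ⟦ X e ⟧ * incidence e v)
      ≡⟨ cong (λ x → net X v + x) (factor ⟦ not (X e) ⟧ ⟦ X e ⟧ (incidence e v)) ⟩
    net X v + (⟦ not (X e) ⟧ - ⟦ X e ⟧) * incidence e v ∎
    where
    open ≡-Reasoning
    factor : ∀ a b x → a * x - b * x ≡ (a - b) * x
    factor = solve-∀

  ResidualStep : Bool → Fin m → Fin n → Fin n → Set
  ResidualStep false e u w = Arc e u w
  ResidualStep true e u w = Arc e w u

  FlowStep : Bool → Fin m → Fin n → Fin n → Set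
  FlowStep b e u w = b ≡ true × Arc e u w

  StepIn : (Bool → Fin m → Fin n → Fin n → Set) → (Fin m → Bool) → Fin m → Fin n → Fin n → Set
  StepIn T X e = T (X e) e

  -- Toggling the arcs of a walk along residual steps (ε = 1) or flow steps (ε = -1) shifts one unit of flow.
  module _ (T : Bool → Fin m → Fin n → Fin n → Set) (ε : ℤ)
           (effect : ∀ {b e u w} → T b e u w → ∀ v →
                     (⟦ not b ⟧ - ⟦ b ⟧) * incidence e v ≡ ε * (δ u v - δ w v)) where

    toggleAlong : ∀ X {x y} (p : Paths.Walk (StepIn T X) ⊤ x y) → Unique (Paths.edges (StepIn T X) ⊤ p) →
      Σ (Fin m → Bool) λ X′ → (∀ v → net X′ v ≡ net X v + ε * (δ x v - δ y v))
        × (∀ e → ¬ e ∈ Paths.edges (StepIn T X) ⊤ p → X′ e ≡ X e)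
        × (∀ e → e ∈ Paths.edges (StepIn T X) ⊤ p → X′ e ≡ not (X e))
    toggleAlong X {x} Paths.[] _ = X , (λ v → sym (unchanged (net X v) ε (δ x v))) , (λ _ _ → refl) , λ _ ()
      where
      unchanged : ∀ a ε d → a + ε * (d - d) ≡ a
      unchanged = solve-∀
    toggleAlong X {x} {y} (Paths.step {w = w} e _ st p) (e∉p ∷ distinct) with toggleAlong X p distinct
    ... | X₁ , net₁ , off₁ , on₁ = toggle X₁ e , net′ , off′ , on′
      where
      X₁e : X₁ e ≡ X e
      X₁e = off₁ e (λ e∈p → All.lookup e∉p e∈p refl)
      telescope : ∀ a ε x w y → a + ε * (w - y) + ε * (x - w) ≡ a + ε * (x - y)
      telescope = solve-∀
      net′ : ∀ v → net (toggle X₁ e) v ≡ net X v + ε * (δ x v - δ y v)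
      net′ v = begin
        net (toggle X₁ e) v
          ≡⟨ net-toggle X₁ e v ⟩
        net X₁ v + (⟦ not (X₁ e) ⟧ - ⟦ X₁ e ⟧) * incidence e v
          ≡⟨ cong₂ _+_ (net₁ v) (effect (subst (λ b → T b e x w) (sym X₁e) st) v) ⟩
        net X v + ε * (δ w v - δ y v) + ε * (δ x v - δ w v)
          ≡⟨ telescope (net X v) ε (δ x v) (δ w v) (δ y v) ⟩
        net X v + ε * (δ x v - δ y v) ∎
        where open ≡-Reasoning
      off′ : ∀ e′ → ¬ e′ ∈ e ∷ Paths.edges (StepIn T X) ⊤ p → toggle X₁ e e′ ≡ X e′
      off′ e′ e′∉ =
        trans (toggle-other X₁ (λ { refl → e′∉ (here refl) })) (off₁ e′ (λ e′∈p → e′∉ (there e′∈p)))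
      on′ : ∀ e′ → e′ ∈ e ∷ Paths.edges (StepIn T X) ⊤ p → toggle X₁ e e′ ≡ not (X e′)
      on′ e′ (here refl) = trans (toggle-same X₁ e) (cong not X₁e)
      on′ e′ (there e′∈p) =
        trans (toggle-other X₁ (λ { refl → All.lookup e∉p e′∈p refl })) (on₁ e′ e′∈p)

  residual-effect : ∀ {b e u w} → ResidualStep b e u w → ∀ v →
    (⟦ not b ⟧ - ⟦ b ⟧) * incidence e v ≡ 1ℤ * (δ u v - δ w v)
  residual-effect {false} (refl , refl) v = refl
  residual-effect {true} {e} (refl , refl) v = reverse (δ (hd e) v) (δ (tl e) v)
    where
    reverse : ∀ a b → (+ 0 - + 1) * (b - a) ≡ + 1 * (a - b)
    reverse = solve-∀

  flow-effect : ∀ {b e u w} → FlowStep b e u w → ∀ v →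
    (⟦ not b ⟧ - ⟦ b ⟧) * incidence e v ≡ -1ℤ * (δ u v - δ w v)
  flow-effect (refl , refl , refl) v = refl

  onFlow : ∀ X {u v} (p : Paths.Walk (StepIn FlowStep X) ⊤ u v) {e} →
    e ∈ Paths.edges (StepIn FlowStep X) ⊤ p → X e ≡ true
  onFlow X (Paths.step e _ st p) (here refl) = proj₁ st
  onFlow X (Paths.step e _ st p) (there e∈p) = onFlow X p e∈p

  leaving entering : (Fin m → Bool) → (Fin n → Bool) → Fin m → Bool
  leaving X R e = X e ∧ R (tl e) ∧ not (R (hd e))
  entering X R e = X e ∧ not (R (tl e)) ∧ R (hd e)

  net-across : ∀ X R → ∑[ v < n ] (⟦ R v ⟧ * net X v) ≡ + count (leaving X R) - + count (entering X R)
  net-across X R = begin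
    ∑[ v < n ] (⟦ R v ⟧ * net X v)
      ≡⟨ sum-cong-≗ (λ v → *-distribˡ-sum ⟦ R v ⟧ (λ e → ⟦ X e ⟧ * incidence e v)) ⟩
    ∑[ v < n ] ∑[ e < m ] (⟦ R v ⟧ * (⟦ X e ⟧ * incidence e v))
      ≡⟨ ∑-comm (λ v e → ⟦ R v ⟧ * (⟦ X e ⟧ * incidence e v)) ⟩
    ∑[ e < m ] ∑[ v < n ] (⟦ R v ⟧ * (⟦ X e ⟧ * incidence e v))
      ≡⟨ sum-cong-≗ arc ⟩
    ∑[ e < m ] (⟦ leaving X R e ⟧ + - ⟦ entering X R e ⟧)
      ≡⟨ ∑-distrib-+ (λ e → ⟦ leaving X R e ⟧) (λ e → - ⟦ entering X R e ⟧) ⟩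
    ∑[ e < m ] ⟦ leaving X R e ⟧ + ∑[ e < m ] (- ⟦ entering X R e ⟧)
      ≡⟨ cong₂ _+_ (∑-⟦⟧ (leaving X R))
                   (trans (∑-neg (λ e → ⟦ entering X R e ⟧)) (cong -_ (∑-⟦⟧ (entering X R)))) ⟩
    + count (leaving X R) - + count (entering X R) ∎
    where
    open ≡-Reasoning
    rearrange : ∀ r x c → r * (x * c) ≡ x * (r * c)
    rearrange = solve-∀
    crossing : ∀ x a b → ⟦ x ⟧ * (⟦ a ⟧ - ⟦ b ⟧) ≡ ⟦ x ∧ a ∧ not b ⟧ + - ⟦ x ∧ not a ∧ b ⟧
    crossing false a b = refl
    crossing true false false = refl
    crossing true false true = refl
    crossing true true false = refl
    crossing true true true = refl
    arc : ∀ e → ∑[ v < n ] (⟦ R v ⟧ * (⟦ X e ⟧ * incidence e v)) ≡ ⟦ leaving X R e ⟧ + - ⟦ entering X R e ⟧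
    arc e = begin
      ∑[ v < n ] (⟦ R v ⟧ * (⟦ X e ⟧ * incidence e v))
        ≡⟨ sum-cong-≗ (λ v → rearrange ⟦ R v ⟧ ⟦ X e ⟧ (incidence e v)) ⟩
      ∑[ v < n ] (⟦ X e ⟧ * (⟦ R v ⟧ * incidence e v))
        ≡⟨ *-distribˡ-sum ⟦ X e ⟧ (λ v → ⟦ R v ⟧ * incidence e v) ⟨
      ⟦ X e ⟧ * ∑[ v < n ] (⟦ R v ⟧ * incidence e v)
        ≡⟨ cong (⟦ X e ⟧ *_) (∑-δ-difference (λ v → ⟦ R v ⟧) (tl e) (hd e)) ⟩
      ⟦ X e ⟧ * (⟦ R (tl e) ⟧ - ⟦ R (hd e) ⟧)
        ≡⟨ crossing (X e) (R (tl e)) (R (hd e)) ⟩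
      ⟦ leaving X R e ⟧ + - ⟦ entering X R e ⟧ ∎

  residualStep? : ∀ X e u w → Dec (StepIn ResidualStep X e u w)
  residualStep? X e u w with X e
  ... | false = (tl e ≟ u) ×-dec (hd e ≟ w)
  ... | true = (tl e ≟ w) ×-dec (hd e ≟ u)

  flowStep? : ∀ X e u w → Dec (StepIn FlowStep X e u w)
  flowStep? X e u w = (X e Bool.≟ true) ×-dec ((tl e ≟ u) ×-dec (hd e ≟ w))

  residual-forward : ∀ {X a} → X a ≡ false → StepIn ResidualStep X a (tl a) (hd a)
  residual-forward Xa rewrite Xa = refl , refl

  residual-backward : ∀ {X a} → X a ≡ true → StepIn ResidualStep X a (hd a) (tl a)
  residual-backward Xa rewrite Xa = refl , refl

  residual-along : ∀ b {e x y} → ResidualStep b e x y → Arc e x y ⊎ Arc e y x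
  residual-along false st = inj₁ st
  residual-along true st = inj₂ st

  module _ (s t : Fin n) where

    IsFlow : (Fin m → Bool) → ℕ → Set
    IsFlow X J = ∀ v → net X v ≡ (δ s v - δ t v) * + J

    flowAcrossCut : ∀ {X J R} → IsFlow X J → R s ≡ true → R t ≡ false →
      + count (leaving X R) - + count (entering X R) ≡ + J
    flowAcrossCut {X} {J} {R} flow Rs Rt = begin
      + count (leaving X R) - + count (entering X R)
        ≡⟨ net-across X R ⟨
      ∑[ v < n ] (⟦ R v ⟧ * net X v)
        ≡⟨ sum-cong-≗ (λ v → cong (⟦ R v ⟧ *_) (flow v)) ⟩
      ∑[ v < n ] (⟦ R v ⟧ * ((δ s v - δ t v) * + J))
        ≡⟨ sum-cong-≗ (λ v → rearrange ⟦ R v ⟧ (δ s v - δ t v) (+ J)) ⟩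
      ∑[ v < n ] (+ J * (⟦ R v ⟧ * (δ s v - δ t v)))
        ≡⟨ *-distribˡ-sum (+ J) (λ v → ⟦ R v ⟧ * (δ s v - δ t v)) ⟨
      + J * ∑[ v < n ] (⟦ R v ⟧ * (δ s v - δ t v))
        ≡⟨ cong (+ J *_) (∑-δ-difference (λ v → ⟦ R v ⟧) s t) ⟩
      + J * (⟦ R s ⟧ - ⟦ R t ⟧)
        ≡⟨ cong₂ (λ a b → + J * (⟦ a ⟧ - ⟦ b ⟧)) Rs Rt ⟩
      + J * + 1
        ≡⟨ ℤP.*-identityʳ (+ J) ⟩
      + J ∎
      where
      open ≡-Reasoning
      rearrange : ∀ r d j → r * (d * j) ≡ j * (r * d)
      rearrange = solve-∀

    module _ {X R} (closed : Closed (StepIn ResidualStep X) ⊤ R) where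

      saturated : ∀ a → R (tl a) ≡ true → R (hd a) ≡ false → leaving X R a ≡ true
      saturated a Rtl Rhd with X a in Xa
      ... | true rewrite Rtl | Rhd = refl
      ... | false with () ← trans (sym (closed a (tl a) (hd a) Rtl ∈⊤ (residual-forward {X} Xa))) Rhd

      noEntering : ∀ a → entering X R a ≡ false
      noEntering a with X a in Xa | R (tl a) in Rtl | R (hd a) in Rhd
      ... | false | _ | _ = refl
      ... | true | true | _ = refl
      ... | true | false | false = refl
      ... | true | false | true
        with () ← trans (sym (closed a (hd a) (tl a) Rhd ∈⊤ (residual-backward {X} Xa))) Rtl

    augment : ∀ {X J} → IsFlow X J → Paths.Path (StepIn ResidualStep X) ⊤ s t →
      Σ (Fin m → Bool) λ X′ → IsFlow X′ (suc J)
    augment {X} {J} flow (p , distinct)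
      with X′ , net′ , _ ← toggleAlong ResidualStep 1ℤ residual-effect X p
             (distinctVertices⇒distinctEdges tl hd (λ {e} → residual-along (X e)) p distinct) =
      X′ , λ v → trans (net′ v)
                   (trans (cong (λ x → x + 1ℤ * (δ s v - δ t v)) (flow v)) (oneMore (δ s v - δ t v) (+ J)))
      where
      oneMore : ∀ d j → d * j + 1ℤ * d ≡ d * (+ 1 + j)
      oneMore = solve-∀

    saturatedCut : ∀ {X J R} → IsFlow X J → Closed (StepIn ResidualStep X) ⊤ R → R s ≡ true → R t ≡ false →
      SmallCut Arc (suc J) s t
    saturatedCut {X} {J} {R} flow closed Rs Rt =
      R , elements (leaving X R) , Rs , Rt , ℕP.≤-reflexive (cong suc cutSize) ,
      λ { a x y (refl , refl) Rx Ry → ∈-elements (leaving X R) a (saturated closed a Rx Ry) }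
      where
      cutSize : length (elements (leaving X R)) ≡ J
      cutSize = trans (length-elements (leaving X R)) (ℤP.+-injective (begin
        + count (leaving X R)                            ≡⟨ ℤP.+-identityʳ _ ⟨
        + count (leaving X R) - + 0                      ≡⟨ cong (λ c → + count (leaving X R) - + c)
                                                              (count-false (noEntering closed)) ⟨
        + count (leaving X R) - + count (entering X R)   ≡⟨ flowAcrossCut {X} flow Rs Rt ⟩
        + J                                              ∎))
        where open ≡-Reasoning

    maxFlowOrSmallCut : ∀ J → (Σ (Fin m → Bool) λ X → IsFlow X J) ⊎ SmallCut Arc J s t
    maxFlowOrSmallCut zero = inj₁ ((λ _ → false) , λ v → trans (net-∅ v) (sym (ℤP.*-zeroʳ (δ s v - δ t v))))
    maxFlowOrSmallCut (suc J) with maxFlowOrSmallCut J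
    ... | inj₂ (R , F , Rs , Rt , small , covers) = inj₂ (R , F , Rs , Rt , ℕP.m<n⇒m<1+n small , covers)
    ... | inj₁ (X , flow) with walkOrClosedCut {S = ⊤} (residualStep? X) s t
    ... | inj₁ walk = inj₁ (augment flow (toPath walk))
    ... | inj₂ (R , Rs , Rt , closed) = inj₂ (saturatedCut flow closed Rs Rt)

    noLeaving : ∀ {X R} → Closed (StepIn FlowStep X) ⊤ R → ∀ a → leaving X R a ≡ false
    noLeaving {X} {R} closed a with X a in Xa | R (tl a) in Rtl | R (hd a) in Rhd
    ... | false | _ | _ = refl
    ... | true | false | _ = refl
    ... | true | true | true = refl
    ... | true | true | false with () ← trans (sym (closed a (tl a) (hd a) Rtl ∈⊤ (Xa , refl , refl))) Rhd

    removePath : ∀ {X J} → IsFlow X (suc J) → (p : Paths.Path (StepIn FlowStep X) ⊤ s t) →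
      Σ (Fin m → Bool) λ X′ → IsFlow X′ J × X′ ⊆ᵇ X
        × (∀ e → e ∈ Paths.edges (StepIn FlowStep X) ⊤ (proj₁ p) → X′ e ≡ false)
    removePath {X} {J} flow (p , distinct)
      with X′ , net′ , off , on ← toggleAlong FlowStep -1ℤ flow-effect X p
             (distinctVertices⇒distinctEdges tl hd (λ st → inj₁ (proj₂ st)) p distinct) =
      X′ , flow′ , X′⊆X , λ e e∈p → trans (on e e∈p) (cong not (onFlow X p e∈p))
      where
      open import Data.List.Membership.DecPropositional (_≟_ {m}) using () renaming (_∈?_ to _∈?ₑ_)
      oneLess : ∀ d j → d * (+ 1 + j) + -1ℤ * d ≡ d * j
      oneLess = solve-∀
      flow′ : IsFlow X′ J
      flow′ v = trans (net′ v)
                  (trans (cong (λ x → x + -1ℤ * (δ s v - δ t v)) (flow v)) (oneLess (δ s v - δ t v) (+ J)))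
      X′⊆X : X′ ⊆ᵇ X
      X′⊆X e X′e with e ∈?ₑ Paths.edges (StepIn FlowStep X) ⊤ p
      ... | yes e∈p = onFlow X p e∈p
      ... | no e∉p = trans (sym (off e e∉p)) X′e

    addPath : ∀ {X X′ J} (p : Paths.Path (StepIn FlowStep X) ⊤ s t) → X′ ⊆ᵇ X →
      (∀ e → e ∈ Paths.edges (StepIn FlowStep X) ⊤ (proj₁ p) → X′ e ≡ false) →
      Paths.KDisjointPaths (StepIn FlowStep X′) ⊤ J s t → Paths.KDisjointPaths (StepIn FlowStep X) ⊤ (suc J) s t
    addPath {X} {X′} p X′⊆X cleared (Q , disjointQ) = P , disjointP
      where
      module W = Paths (StepIn FlowStep X) ⊤
      module W′ = Paths (StepIn FlowStep X′) ⊤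
      P : Fin (suc _) → W.Path s t
      P zero = p
      P (suc i) = mapPath id (Q i) (λ _ st → (X′⊆X _ (proj₁ st) , proj₂ st) , ∈⊤)
      onQ : ∀ i {e} → e ∈ W.edges (proj₁ (P (suc i))) → e ∈ W′.edges (proj₁ (Q i))
      onQ i {e} = subst (e ∈_) (trans (edges-mapWalk id (proj₁ (Q i)) _) (map-id _))
      disjointP : ∀ i j → i ≢ j → W.EdgeDisjoint (P i) (P j)
      disjointP zero zero i≢j = ⊥-elim (i≢j refl)
      disjointP zero (suc j) _ e e∈p e∈Q
        with () ← trans (sym (cleared e e∈p)) (onFlow X′ (proj₁ (Q j)) (onQ j e∈Q))
      disjointP (suc i) zero _ e e∈Q e∈p
        with () ← trans (sym (cleared e e∈p)) (onFlow X′ (proj₁ (Q i)) (onQ i e∈Q))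
      disjointP (suc i) (suc j) i≢j e e∈Qi e∈Qj = disjointQ i j (i≢j ∘ cong suc) e (onQ i e∈Qi) (onQ j e∈Qj)

    flow⇒disjointPaths : ∀ J X → IsFlow X J → Paths.KDisjointPaths (StepIn FlowStep X) ⊤ J s t
    flow⇒disjointPaths zero X flow = (λ ()) , λ ()
    flow⇒disjointPaths (suc J) X flow with walkOrClosedCut {S = ⊤} (flowStep? X) s t
    ... | inj₁ walk with X′ , flow′ , X′⊆X , cleared ← removePath flow (toPath walk) =
      addPath (toPath walk) X′⊆X cleared (flow⇒disjointPaths J X′ flow′)
    ... | inj₂ (R , Rs , Rt , closed) = ⊥-elim (negative (count (entering X R)) (begin
      + 0 - + count (entering X R)                    ≡⟨ cong (λ c → + c - + count (entering X R))
                                                             (count-false (noLeaving closed)) ⟨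
      + count (leaving X R) - + count (entering X R)  ≡⟨ flowAcrossCut {X} flow Rs Rt ⟩
      + suc J                                         ∎))
      where
      open ≡-Reasoning
      negative : ∀ c → + 0 - + c ≢ + suc J
      negative zero ()
      negative (suc c) ()

menger-digraph : (D : Digraph) → Menger (DStep D)
menger-digraph D u v J =
  map₁ (λ (X , flow) → mapDisjointPaths id proj₂ (λ _ _ → id) (flow⇒disjointPaths u v J X flow))
       (maxFlowOrSmallCut u v J)
  where open Flow (Digraph.tail D) (Digraph.head D)

module Doubled (G : Graph) where
  open Graph G

  forward backward : Fin nE → Fin (nE ℕ.+ nE)
  forward e = e ↑ˡ nE
  backward e = nE ↑ʳ e

  data View : Fin (nE ℕ.+ nE) → Set where
    fwd : ∀ e → View (forward e)
    bwd : ∀ e → View (backward e)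

  view : ∀ a → View a
  view a with splitAt nE a in eq
  ... | inj₁ e = subst View (splitAt⁻¹-↑ˡ eq) (fwd e)
  ... | inj₂ e = subst View (splitAt⁻¹-↑ʳ eq) (bwd e)

  arcEnds′ : Fin (nE ℕ.+ nE) → Fin nV × Fin nV
  arcEnds′ a = [ ends , swap ∘ ends ]′ (splitAt nE a)

  tl hd : Fin (nE ℕ.+ nE) → Fin nV
  tl = proj₁ ∘ arcEnds′
  hd = proj₂ ∘ arcEnds′

  edgeOf : Fin (nE ℕ.+ nE) → Fin nE
  edgeOf a = [ id , id ]′ (splitAt nE a)

  arcEnds-forward : ∀ e → arcEnds′ (forward e) ≡ ends e
  arcEnds-forward e = cong [ ends , swap ∘ ends ]′ (splitAt-↑ˡ nE e nE)

  arcEnds-backward : ∀ e → arcEnds′ (backward e) ≡ swap (ends e)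
  arcEnds-backward e = cong [ ends , swap ∘ ends ]′ (splitAt-↑ʳ nE nE e)

  edgeOf-forward : ∀ e → edgeOf (forward e) ≡ e
  edgeOf-forward e = cong [ id , id ]′ (splitAt-↑ˡ nE e nE)

  edgeOf-backward : ∀ e → edgeOf (backward e) ≡ e
  edgeOf-backward e = cong [ id , id ]′ (splitAt-↑ʳ nE nE e)

  forward≢backward : ∀ e → forward e ≢ backward e
  forward≢backward e eq with () ← trans (sym (splitAt-↑ˡ nE e nE)) (trans (cong (splitAt nE) eq) (splitAt-↑ʳ nE nE e))

  open Flow tl hd
  open IntegerSums
  open import Data.Integer using (_+_; _-_; -_; _*_)

  arc⇒edge : ∀ {a x y} → Arc a x y → GStep G (edgeOf a) x y
  arc⇒edge {a} (refl , refl) with view a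
  ... | fwd e rewrite edgeOf-forward e = inj₁ (sym (arcEnds-forward e))
  ... | bwd e rewrite edgeOf-backward e = inj₂ (cong swap (sym (arcEnds-backward e)))

  edge⇒arc : ∀ {e x y} → GStep G e x y → ∃ λ a → Arc a x y × edgeOf a ≡ e
  edge⇒arc {e} (inj₁ refl) =
    forward e , (cong proj₁ (arcEnds-forward e) , cong proj₂ (arcEnds-forward e)) , edgeOf-forward e
  edge⇒arc {e} (inj₂ refl) =
    backward e , (cong proj₁ (arcEnds-backward e) , cong proj₂ (arcEnds-backward e)) , edgeOf-backward e

  OneWay : (Fin (nE ℕ.+ nE) → Bool) → Fin nE → Set
  OneWay X e = X (forward e) ∧ X (backward e) ≡ false

  oneWay-⊆ : ∀ {X X′} e → X′ ⊆ᵇ X → OneWay X e → OneWay X′ e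
  oneWay-⊆ {X} {X′} e X′⊆X oneWay with X′ (forward e) in f | X′ (backward e) in b
  ... | false | _ = refl
  ... | true | false = refl
  ... | true | true with () ← trans (sym (cong₂ _∧_ (X′⊆X _ f) (X′⊆X _ b))) oneWay

  oneWay-edgeOf-injective : ∀ {X} → (∀ e → OneWay X e) →
    ∀ {a b} → X a ≡ true → X b ≡ true → edgeOf a ≡ edgeOf b → a ≡ b
  oneWay-edgeOf-injective {X} oneWay {a} {b} Xa Xb eq with view a | view b
  ... | fwd e | fwd e′ rewrite edgeOf-forward e | edgeOf-forward e′ | eq = refl
  ... | bwd e | bwd e′ rewrite edgeOf-backward e | edgeOf-backward e′ | eq = refl
  ... | fwd e | bwd e′ rewrite edgeOf-forward e | edgeOf-backward e′ | eq
    with () ← trans (sym (cong₂ _∧_ Xa Xb)) (oneWay e′)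
  ... | bwd e | fwd e′ rewrite edgeOf-backward e | edgeOf-forward e′ | eq
    with () ← trans (sym (cong₂ _∧_ Xb Xa)) (oneWay e′)

  incidence-backward : ∀ e v → incidence (backward e) v ≡ - incidence (forward e) v
  incidence-backward e v = begin
    incidence (backward e) v
      ≡⟨ cong₂ (λ x y → δ x v - δ y v) (cong proj₁ (arcEnds-backward e)) (cong proj₂ (arcEnds-backward e)) ⟩
    δ (proj₂ (ends e)) v - δ (proj₁ (ends e)) v
      ≡⟨ antisymmetric (δ (proj₁ (ends e)) v) (δ (proj₂ (ends e)) v) ⟩
    - (δ (proj₁ (ends e)) v - δ (proj₂ (ends e)) v)
      ≡⟨ cong₂ (λ x y → - (δ x v - δ y v)) (cong proj₁ (arcEnds-forward e)) (cong proj₂ (arcEnds-forward e)) ⟨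
    - incidence (forward e) v ∎
    where
    open ≡-Reasoning
    antisymmetric : ∀ a b → b - a ≡ - (a - b)
    antisymmetric = solve-∀

  module _ (s t : Fin nV) where

    cancelPair : ∀ {X J} e → IsFlow s t X J →
      Σ (Fin (nE ℕ.+ nE) → Bool) λ X′ → IsFlow s t X′ J × X′ ⊆ᵇ X × OneWay X′ e
    cancelPair {X} {J} e flow with X (forward e) in f | X (backward e) in b
    ... | false | _ = X , flow , (λ _ → id) , cong (_∧ X (backward e)) f
    ... | true | false = X , flow , (λ _ → id) , cong₂ _∧_ f b
    ... | true | true = X₂ , flow′ , X₂⊆X , oneWay
      where
      X₁ X₂ : Fin (nE ℕ.+ nE) → Bool
      X₁ = toggle X (forward e)
      X₂ = toggle X₁ (backward e)
      X₁b : X₁ (backward e) ≡ true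
      X₁b = trans (toggle-other X (forward≢backward e ∘ sym)) b
      cancel : ∀ a c → a + (+ 0 - + 1) * c + (+ 0 - + 1) * - c ≡ a
      cancel = solve-∀
      flow′ : IsFlow s t X₂ J
      flow′ v = begin
        net X₂ v
          ≡⟨ net-toggle X₁ (backward e) v ⟩
        net X₁ v + (⟦ not (X₁ (backward e)) ⟧ - ⟦ X₁ (backward e) ⟧) * incidence (backward e) v
          ≡⟨ cong₂ (λ n′ x → n′ + (⟦ not x ⟧ - ⟦ x ⟧) * incidence (backward e) v)
                   (net-toggle X (forward e) v) X₁b ⟩
        net X v + (⟦ not (X (forward e)) ⟧ - ⟦ X (forward e) ⟧) * incidence (forward e) v
                + (+ 0 - + 1) * incidence (backward e) v
          ≡⟨ cong₂ (λ x c → net X v + (⟦ not x ⟧ - ⟦ x ⟧) * incidence (forward e) v + (+ 0 - + 1) * c)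
                   f (incidence-backward e v) ⟩
        net X v + (+ 0 - + 1) * incidence (forward e) v + (+ 0 - + 1) * - incidence (forward e) v
          ≡⟨ cancel (net X v) (incidence (forward e) v) ⟩
        net X v
          ≡⟨ flow v ⟩
        (δ s v - δ t v) * + J ∎
        where open ≡-Reasoning
      X₂⊆X : X₂ ⊆ᵇ X
      X₂⊆X a X₂a with a ≟ backward e | a ≟ forward e
      ... | yes refl | _ = b
      ... | no _ | yes refl = f
      ... | no _ | no _ = X₂a
      oneWay : OneWay X₂ e
      oneWay = trans (cong (X₂ (forward e) ∧_) (trans (toggle-same X₁ (backward e)) (cong not X₁b))) (∧-zeroʳ _)

    cancelAll : ∀ {X J} (Ls : List (Fin nE)) → IsFlow s t X J →
      Σ (Fin (nE ℕ.+ nE) → Bool) λ X′ → IsFlow s t X′ J × X′ ⊆ᵇ X × (∀ e → e ∈ Ls → OneWay X′ e)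
    cancelAll {X} [] flow = X , flow , (λ _ → id) , λ _ ()
    cancelAll (e ∷ Ls) flow
      with X₁ , flow₁ , X₁⊆X , oneWay₁ ← cancelPair e flow
      with X′ , flow′ , X′⊆X₁ , oneWay′ ← cancelAll Ls flow₁
      = X′ , flow′ , (λ a → X₁⊆X a ∘ X′⊆X₁ a) , λ where
          e′ (here refl) → oneWay-⊆ e X′⊆X₁ oneWay₁
          e′ (there e′∈Ls) → oneWay′ e′ e′∈Ls

  menger : Menger (GStep G)
  menger u v J with maxFlowOrSmallCut u v J
  ... | inj₂ (R , F , Ru , Rv , small , covers) =
    inj₂ (R , map edgeOf F , Ru , Rv , subst (ℕ._< J) (sym (length-map edgeOf F)) small , covers′)
    where
    covers′ : ∀ e x y → GStep G e x y → R x ≡ true → R y ≡ false → e ∈ map edgeOf F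
    covers′ e x y st Rx Ry with a , arc , refl ← edge⇒arc st = ∈-map⁺ edgeOf (covers a x y arc Rx Ry)
  ... | inj₁ (X₀ , flow₀) with X , flow , _ , oneWay ← cancelAll u v {X₀} (allFin nE) flow₀ =
    inj₁ (mapDisjointPaths edgeOf (λ st → arc⇒edge (proj₂ st))
            (λ sta stb → oneWay-edgeOf-injective (λ e → oneWay e (∈-allFin e)) (proj₁ sta) (proj₁ stb))
            (flow⇒disjointPaths u v J X flow))

menger-graph : (G : Graph) → Menger (GStep G)
menger-graph = Doubled.menger

open import Data.Nat using (_+_)

does-∈? : ∀ {c} (x : Fin c) (p : Subset c) → does (x ∈ₛ? p) ≡ lookup p x
does-∈? zero (true Vec.∷ p) = refl
does-∈? zero (false Vec.∷ p) = refl
does-∈? (suc x) (_ Vec.∷ p) = does-∈? x p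

lookup-surviving : ∀ {m c} (f : Fin m → Fin c) (C′ : Subset c) e →
  lookup (surviving f C′) e ≡ not (lookup C′ (f e))
lookup-surviving f C′ e = trans (VecP.lookup∘tabulate _ e) (ifNot (does-∈? (f e) C′))
  where
  ifNot : ∀ {a b} → a ≡ b → (Bool.if a then outside else inside) ≡ not b
  ifNot {false} refl = refl
  ifNot {true} refl = refl

module _ {m c : ℕ} (f : Fin m → Fin c) where
  open import Data.List.Membership.DecPropositional (_≟_ {c}) using () renaming (_∈?_ to _∈?ᶜ_)

  colorsOf : List (Fin m) → Subset c
  colorsOf Fl = tabulate λ x → does (x ∈?ᶜ map f Fl)

  ∣colorsOf∣≤length : ∀ Fl → ∣ colorsOf Fl ∣ ≤ length Fl
  ∣colorsOf∣≤length Fl = begin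
    ∣ colorsOf Fl ∣                          ≡⟨ ∣p∣≡count (colorsOf Fl) ⟩
    count (lookup (colorsOf Fl))             ≡⟨ count-cong (VecP.lookup∘tabulate (λ x → does (x ∈?ᶜ map f Fl))) ⟩
    count (λ x → does (x ∈?ᶜ map f Fl))      ≤⟨ count≤length (map f Fl) fromDoes ⟩
    length (map f Fl)                        ≡⟨ length-map f Fl ⟩
    length Fl                                ∎
    where
    open ℕP.≤-Reasoning
    fromDoes : ∀ x → does (x ∈?ᶜ map f Fl) ≡ true → x ∈ map f Fl
    fromDoes x _ with x ∈?ᶜ map f Fl
    fromDoes x _ | yes x∈ = x∈
    fromDoes x () | no _

  survivor∉ : ∀ Fl e → e ∈ₛ surviving f (colorsOf Fl) → ¬ e ∈ Fl
  survivor∉ Fl e survives e∈Fl with f e ∈?ᶜ map f Fl in colored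
  ... | no fe∉ = fe∉ (∈-map⁺ f e∈Fl)
  ... | yes _ with () ← trans (sym (VecP.[]=⇒lookup survives))
                     (trans (lookup-surviving f (colorsOf Fl) e)
                            (cong not (trans (VecP.lookup∘tabulate _ (f e)) (cong does colored))))

  deleteColorsOfPrefix : ∀ ℓ (D : List (Fin m)) →
    Σ (Subset c) λ C′ → ∣ C′ ∣ ≤ ℓ × (∀ e → e ∈ D → e ∈ₛ surviving f C′ → e ∈ drop ℓ D)
  deleteColorsOfPrefix ℓ D = colorsOf (take ℓ D) , few , inSuffix
    where
    few : ∣ colorsOf (take ℓ D) ∣ ≤ ℓ
    few = begin
      ∣ colorsOf (take ℓ D) ∣  ≤⟨ ∣colorsOf∣≤length (take ℓ D) ⟩
      length (take ℓ D)       ≡⟨ length-take ℓ D ⟩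
      ℓ ℕ.⊓ length D           ≤⟨ ℕP.m⊓n≤m ℓ _ ⟩
      ℓ                       ∎
      where open ℕP.≤-Reasoning
    inSuffix : ∀ e → e ∈ D → e ∈ₛ surviving f (colorsOf (take ℓ D)) → e ∈ drop ℓ D
    inSuffix e e∈D survives with ∈-++⁻ (take ℓ D) (subst (e ∈_) (sym (take++drop≡id ℓ D)) e∈D)
    ... | inj₁ e∈prefix = ⊥-elim (survivor∉ (take ℓ D) e survives e∈prefix)
    ... | inj₂ e∈suffix = e∈suffix

length-drop< : ∀ {A : Set} {k} ℓ (xs : List A) → 1 ≤ k → length xs < k + ℓ → length (drop ℓ xs) < k
length-drop< {k = k} ℓ xs k≥1 short = subst (_< k) (sym (length-drop ℓ xs))
  (ℕP.m<n+o⇒m∸n<o (length xs) ℓ {{ℕ.>-nonZero k≥1}} (subst (length xs <_) (ℕP.+-comm k ℓ) short))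

uncolored⇒surviving : ∀ {m} (C′ : Subset m) e → ¬ e ∈ elements (lookup C′) → e ∈ₛ surviving id C′
uncolored⇒surviving C′ e e∉ =
  VecP.lookup⇒[]= e _ (trans (lookup-surviving id C′ e) (uncolored (lookup C′ e) refl))
  where
  uncolored : ∀ b → lookup C′ e ≡ b → not b ≡ true
  uncolored false _ = refl
  uncolored true C′e = ⊥-elim (e∉ (∈-elements (lookup C′) e C′e))

length-elements+k≤k+ℓ : ∀ {m} k ℓ (C′ : Subset m) → ∣ C′ ∣ ≤ ℓ →
  length (elements (lookup C′)) + k ≤ k + ℓ
length-elements+k≤k+ℓ k ℓ C′ few = subst (_≤ k + ℓ) (ℕP.+-comm k _)
  (ℕP.+-monoʳ-≤ k (subst (_≤ ℓ) (trans (∣p∣≡count C′) (sym (length-elements (lookup C′)))) few))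

module _ {n m : ℕ} {Step : Fin m → Fin n → Fin n → Set} {u v : Fin n} (k ℓ : ℕ) where

  survivingPaths : (C′ : Subset m) → ∣ C′ ∣ ≤ ℓ →
    Paths.KDisjointPaths Step ⊤ (k + ℓ) u v → Paths.KDisjointPaths Step (surviving id C′) k u v
  survivingPaths C′ few paths
    with (P , disjoint) , avoid ← disjointPathsAvoiding (elements (lookup C′)) k
                                    (fewerPaths (length-elements+k≤k+ℓ k ℓ C′ few) paths) =
    Q , λ i j i≢j e e∈i e∈j →
      disjoint i j i≢j e (subst (e ∈_) (restricted i) e∈i) (subst (e ∈_) (restricted j) e∈j)
    where
    Q : Fin k → Paths.Path Step (surviving id C′) u v
    Q i = mapPath id (P i) (λ {e} e∈ st → st , uncolored⇒surviving C′ e (avoid i e e∈))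
    restricted : ∀ i → Paths.edges Step (surviving id C′) (proj₁ (Q i)) ≡ Paths.edges Step ⊤ (proj₁ (P i))
    restricted i = trans (edges-mapWalk id (proj₁ (P i)) _) (map-id _)

  pathsFromColorAvoiding : Menger Step → 1 ≤ k → ∀ {c} (f : Fin m → Fin c) →
    (∀ C′ → ∣ C′ ∣ ≤ ℓ → Paths.KDisjointPaths Step (surviving f C′) k u v) →
    Paths.KDisjointPaths Step ⊤ (k + ℓ) u v
  pathsFromColorAvoiding menger k≥1 f avoid with menger u v (k + ℓ)
  ... | inj₁ P = P
  ... | inj₂ (R , F , Ru , Rv , short , covers) with C′ , few , inSuffix ← deleteColorsOfPrefix f ℓ F =
    ⊥-elim (ℕP.<⇒≱ (length-drop< ℓ F k≥1 short)
      (disjointPaths≤crossing R (drop ℓ F) (avoid C′ few) Ru Rv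
        (λ e x y survives st Rx Ry → inSuffix e (covers e x y st Rx Ry) survives)))

loopsSurvive : ∀ {m} k ℓ (L C′ : Subset m) → k + ℓ ≤ ∣ ⊤ ∩ L ∣ → ∣ C′ ∣ ≤ ℓ →
  k ≤ ∣ surviving id C′ ∩ L ∣
loopsSurvive k ℓ L C′ many few = ℕP.+-cancelʳ-≤ ℓ k _ (begin
  k + ℓ                             ≤⟨ many ⟩
  ∣ ⊤ ∩ L ∣                         ≡⟨ cong ∣_∣ (∩-identityˡ L) ⟩
  ∣ L ∣                             ≤⟨ deleted ⟩
  ∣ surviving id C′ ∩ L ∣ + ∣ C′ ∣  ≤⟨ ℕP.+-monoʳ-≤ _ few ⟩
  ∣ surviving id C′ ∩ L ∣ + ℓ       ∎)
  where
  open ℕP.≤-Reasoning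
  deleted : ∣ L ∣ ≤ ∣ surviving id C′ ∩ L ∣ + ∣ C′ ∣
  deleted rewrite ∣p∣≡count L | ∣p∩q∣≡count (surviving id C′) L | ∣p∣≡count C′ = count-≤-+ split
    where
    split : ∀ e →
      fromBool (lookup L e) ≤ fromBool (lookup (surviving id C′) e ∧ lookup L e) + fromBool (lookup C′ e)
    split e rewrite lookup-surviving id C′ e with lookup L e | lookup C′ e
    ... | false | _ = z≤n
    ... | true | true = s≤s z≤n
    ... | true | false = s≤s z≤n

loopsFromColorAvoiding : ∀ {m c} k ℓ (L : Subset m) (f : Fin m → Fin c) → 1 ≤ k →
  (∀ C′ → ∣ C′ ∣ ≤ ℓ → k ≤ ∣ surviving f C′ ∩ L ∣) → k + ℓ ≤ ∣ ⊤ ∩ L ∣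
loopsFromColorAvoiding k ℓ L f k≥1 avoid with k + ℓ ℕP.≤? ∣ ⊤ ∩ L ∣
... | yes many = many
... | no ¬many with C′ , few , inSuffix ← deleteColorsOfPrefix f ℓ (elements (lookup L)) =
  ⊥-elim (ℕP.<⇒≱ (length-drop< ℓ loops k≥1 (subst (_< k + ℓ) total (ℕP.≰⇒> ¬many))) (begin
    k                                                     ≤⟨ avoid C′ few ⟩
    ∣ surviving f C′ ∩ L ∣                                ≡⟨ ∣p∩q∣≡count (surviving f C′) L ⟩
    count (λ e → lookup (surviving f C′) e ∧ lookup L e)  ≤⟨ count≤length (drop ℓ loops) survivingLoop ⟩
    length (drop ℓ loops)                                 ∎))
  where
  open ℕP.≤-Reasoning
  loops : List _
  loops = elements (lookup L)
  total : ∣ ⊤ ∩ L ∣ ≡ length loops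
  total = trans (cong ∣_∣ (∩-identityˡ L)) (trans (∣p∣≡count L) (sym (length-elements (lookup L))))
  survivingLoop : ∀ e → lookup (surviving f C′) e ∧ lookup L e ≡ true → e ∈ drop ℓ loops
  survivingLoop e both with lookup (surviving f C′) e in survives | lookup L e in loop
  survivingLoop e () | false | _
  survivingLoop e () | true | false
  ... | true | true = inSuffix e (∈-elements (lookup L) e loop) (VecP.lookup⇒[]= e _ survives)

module ColorAvoidance {m : ℕ} (nV : ℕ) (L : Subset m) (Linked : Subset m → ℕ → Set) where

  Connected : Subset m → ℕ → Set
  Connected S k = (2 ≤ nV × Linked S k) ⊎ (nV ≡ 1 × k ≤ ∣ S ∩ L ∣)

  HasColoring : ℕ → ℕ → Set
  HasColoring ℓ k =
    Σ ℕ λ c → Σ (Fin m → Fin c) λ f → ∀ C′ → ∣ C′ ∣ ≤ ℓ → Connected (surviving f C′) k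

  hasColoring⇔connected : ∀ k ℓ → 1 ≤ k →
    (∀ C′ → ∣ C′ ∣ ≤ ℓ → Linked ⊤ (k + ℓ) → Linked (surviving id C′) k) →
    (∀ {c} (f : Fin m → Fin c) → (∀ C′ → ∣ C′ ∣ ≤ ℓ → Linked (surviving f C′) k) →
      Linked ⊤ (k + ℓ)) →
    HasColoring ℓ k ⇔ Connected ⊤ (k + ℓ)
  hasColoring⇔connected k ℓ k≥1 survive fromAvoiding = mk⇔ to from
    where
    2≤1 : 2 ≤ nV → nV ≡ 1 → Data.Empty.⊥
    2≤1 (s≤s ()) refl
    to : HasColoring ℓ k → Connected ⊤ (k + ℓ)
    to (c , f , avoid) with avoid ⊥ (subst (_≤ ℓ) (sym (∣⊥∣≡0 c)) z≤n)
    ... | inj₁ (two , _) = inj₁ (two , fromAvoiding f linked)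
      where
      linked : ∀ C′ → ∣ C′ ∣ ≤ ℓ → Linked (surviving f C′) k
      linked C′ few with avoid C′ few
      ... | inj₁ (_ , linkedC′) = linkedC′
      ... | inj₂ (one , _) = ⊥-elim (2≤1 two one)
    ... | inj₂ (one , _) = inj₂ (one , loopsFromColorAvoiding k ℓ L f k≥1 loops)
      where
      loops : ∀ C′ → ∣ C′ ∣ ≤ ℓ → k ≤ ∣ surviving f C′ ∩ L ∣
      loops C′ few with avoid C′ few
      ... | inj₁ (two , _) = ⊥-elim (2≤1 two one)
      ... | inj₂ (_ , loopsC′) = loopsC′
    from : Connected ⊤ (k + ℓ) → HasColoring ℓ k
    from (inj₁ (two , linked)) = m , id , λ C′ few → inj₁ (two , survive C′ few linked)
    from (inj₂ (one , loops)) = m , id , λ C′ few → inj₂ (one , loopsSurvive k ℓ L C′ loops few)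

module _ {n m : ℕ} {Step : Fin m → Fin n → Fin n → Set} (menger : Menger Step) (L : Subset m) {k : ℕ} (ℓ : ℕ)
         (k≥1 : 1 ≤ k) where

  AllPairsLinked : Subset m → ℕ → Set
  AllPairsLinked S j = ∀ u v → u ≢ v → Paths.KDisjointPaths Step S j u v

  RootLinked : Fin n → Subset m → ℕ → Set
  RootLinked r S j = ∀ v → r ≢ v → Paths.KDisjointPaths Step S j r v

  colorAvoiding⇔allPairs :
    ColorAvoidance.HasColoring n L AllPairsLinked ℓ k ⇔ ColorAvoidance.Connected n L AllPairsLinked ⊤ (k + ℓ)
  colorAvoiding⇔allPairs = ColorAvoidance.hasColoring⇔connected n L AllPairsLinked k ℓ k≥1
    (λ C′ few linked u v u≢v → survivingPaths k ℓ C′ few (linked u v u≢v))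
    (λ f avoid u v u≢v → pathsFromColorAvoiding k ℓ menger k≥1 f (λ C′ few → avoid C′ few u v u≢v))

  colorAvoiding⇔fromRoot : ∀ r →
    ColorAvoidance.HasColoring n L (RootLinked r) ℓ k ⇔ ColorAvoidance.Connected n L (RootLinked r) ⊤ (k + ℓ)
  colorAvoiding⇔fromRoot r = ColorAvoidance.hasColoring⇔connected n L (RootLinked r) k ℓ k≥1
    (λ C′ few linked v r≢v → survivingPaths k ℓ C′ few (linked v r≢v))
    (λ f avoid v r≢v → pathsFromColorAvoiding k ℓ menger k≥1 f (λ C′ few → avoid C′ few v r≢v))

proposition3p1 : (k ℓ : ℕ) → 1 ≤ k → 1 ≤ ℓ →
    ((G : Graph) → HasEdgeColorAvoidingColoring G ℓ k ⇔ EdgeConnected G (k + ℓ))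
    × ((D : Digraph) → HasArcColorAvoidingStrongColoring D ℓ k ⇔ StronglyConnected D (k + ℓ))
    × ((D : Digraph) → (r : Fin (Digraph.nV D)) →
         HasArcColorAvoidingRootedColoring D r ℓ k ⇔ RootedConnected D r (k + ℓ))
proposition3p1 k ℓ k≥1 _ =
  (λ G → colorAvoiding⇔allPairs (menger-graph G) (loopSet (Graph.ends G)) ℓ k≥1) ,
  (λ D → colorAvoiding⇔allPairs (menger-digraph D) (loopSet (arcEnds D)) ℓ k≥1) ,
  (λ D r → colorAvoiding⇔fromRoot (menger-digraph D) (loopSet (arcEnds D)) ℓ k≥1 r)
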